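{- Let $G=(V,E)$ be an undirected graph and let $\chi$ be any monitor placement for $G$. Under either the $\mathrm{CSP}$ or the $\mathrm{CAP}^-$ routing mechanism, $\mu(G\mid\chi)\le\delta(G)$, where $\delta(G)$ is the minimum degree of $G$.
   Context: A monitor placement $\chi=(\mathfrak m,\mathfrak M)$ for $G=(V,E)$ specifies a set $\mathfrak m\subseteq V$ of input nodes and a set $\mathfrak M\subseteq V$ of output nodes. The set of measurement paths $\mathbb P(G\mid\chi)$ depends on the routing mechanism: under $\mathrm{CSP}$ it consists of all simple (no repeated node) paths from a node of $\mathfrak m$ to a different node of $\mathfrak M$; under $\mathrm{CAP}^-$ it consists of all walks (repeated nodes and edges, and cycles, allowed) starting at a node of $\mathfrak m$ and ending at a node of $\mathfrak M$, except that the degenerate single-node path consisting of one node $v\in\mathfrak m\cap\mathfrak M$ is not allowed. For a node $v$, $\mathbb P(v)$ is the set of measurement paths passing through $v$, and $\mathbb P(U)=\bigcup_{u\in U}\mathbb P(u)$. $V$ is $k$-identifiable if for all $U,W\subseteq V$ with $U\neq W$ and $|U|,|W|\le k$, $\mathbb P(U)\neq\mathbb P(W)$. $\mu(G\mid\chi)$ is the largest $k\ge0$ such that $V$ is $k$-identifiable with respect to $\mathbb P(G\mid\chi)$. -}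

module Defs where

open import Data.Nat using (ℕ; zero; suc; _+_; _≤_; _⊔_; _⊓_)
open import Data.Bool using (Bool; true; false)
open import Data.Fin using (Fin; zero; suc)
open import Data.Fin.Subset using (Subset) renaming (_∈_ to _∈ₛ_)
import Data.Fin.Subset as S
open import Data.List using (List; []; _∷_; head; last; length)
open import Data.List.Membership.Propositional using () renaming (_∈_ to _∈ₗ_)
open import Data.List.Relation.Unary.Linked using (Linked)
open import Data.List.Relation.Unary.Unique.Propositional using (Unique)
open import Data.Maybe using (just)
open import Data.Product using (Σ; ∃; _×_)
open import Relation.Binary.PropositionalEquality using (_≡_; _≢_)
open import Relation.Nullary using (¬_)
open import Function.Bundles using (_⇔_)

record Graph (n : ℕ) : Set where
  field
    adj   : Fin n → Fin n → Bool
    sym   : ∀ x y → adj x y ≡ adj y x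
    irrfl : ∀ x → adj x x ≡ false
open Graph public

Adj : ∀ {n} → Graph n → Fin n → Fin n → Set
Adj G x y = adj G x y ≡ true

count : ∀ {n} → (Fin n → Bool) → ℕ
count {zero}  f = 0
count {suc n} f with f zero
... | true  = suc (count (λ i → f (suc i)))
... | false = count (λ i → f (suc i))

degree : ∀ {n} → Graph n → Fin n → ℕ
degree G v = count (adj G v)

minOver : ∀ {m} → (Fin (suc m) → ℕ) → ℕ
minOver {zero}  f = f zero
minOver {suc m} f = f zero ⊓ minOver (λ i → f (suc i))

δ : ∀ {m} → Graph (suc m) → ℕ
δ G = minOver (degree G)

record Placement (n : ℕ) : Set where
  field
    inputs  : Subset n
    outputs : Subset n
open Placement public

data Routing : Set where
  CSP  : Routing
  CAP⁻ : Routing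

Walk : ∀ {n} → Graph n → List (Fin n) → Set
Walk G p = Linked (Adj G) p

Measurement : ∀ {n} → Routing → Graph n → Placement n → List (Fin n) → Set
Measurement CSP G χ p =
  Walk G p × Unique p ×
  Σ (Fin _) λ s → Σ (Fin _) λ t →
    head p ≡ just s × last p ≡ just t × s ∈ₛ inputs χ × t ∈ₛ outputs χ × s ≢ t
Measurement CAP⁻ G χ p =
  Walk G p ×
  Σ (Fin _) λ s → Σ (Fin _) λ t →
    head p ≡ just s × last p ≡ just t × s ∈ₛ inputs χ × t ∈ₛ outputs χ ×
    2 ≤ length p   -- excludes only the degenerate single-node path

InP : ∀ {n} → Subset n → List (Fin n) → Set
InP U p = ∃ λ u → u ∈ₛ U × u ∈ₗ p

SamePaths : ∀ {n} → Routing → Graph n → Placement n → Subset n → Subset n → Set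
SamePaths r G χ U W = ∀ p → Measurement r G χ p → (InP U p ⇔ InP W p)

Identifiable : ∀ {n} → Routing → Graph n → Placement n → ℕ → Set
Identifiable r G χ k =
  ∀ (U W : Subset _) → S.∣ U ∣ ≤ k → S.∣ W ∣ ≤ k → U ≢ W → ¬ SamePaths r G χ U W

IsMu : ∀ {n} → Routing → Graph n → Placement n → ℕ → Set
IsMu r G χ k = Identifiable r G χ k × (∀ k′ → Identifiable r G χ k′ → k′ ≤ k)

module Submission where

-- Let v be a vertex of minimum degree, N(v) its open and
-- N[v] = {v} ∪ N(v) its closed neighbourhood, of sizes δ(G) and ≤ δ(G) + 1.
-- Every measurement path has at least two nodes, so a measurement path
-- through v also passes through a neighbour of v on it.  Hence
-- ℙ(N(v)) = ℙ(N[v]) although N(v) ≠ N[v]: V is not (δ(G)+1)-identifiable.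
--
-- The statement asks for an actual μ, which constructively
-- requires deciding k-identifiability.  ℙ(U) = ℙ(W) fails iff some
-- measurement path passes through one of U, W and avoids the other, and
-- such a separating path can always be chosen of bounded length: CSP paths
-- have no repeated node (length ≤ n), and a CAP⁻ walk longer than 2n+1
-- repeats a node on one side of a chosen node u, so cutting out the cycle
-- keeps it separating.  Bounded search then decides identifiability, and
-- since identifiability is downward closed, holds for k = 0 and fails for
-- k = δ(G)+1, the largest identifiable k exists and is at most δ(G).

open import Defs hiding (sym)
open import Data.Nat using (ℕ; zero; suc; _+_; _≤_; _<_; z≤n; s≤s; _≤?_; _<?_)
open import Data.Nat.Properties
  using (≤-refl; ≤-trans; ≤-reflexive; n≤1+n; m≤n⇒m≤1+n; ≰⇒>; ≮⇒≥; ≤⇒≯;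
         +-suc; +-mono-≤; ≤-total; m≤n⇒m⊓n≡m; m≥n⇒m⊓n≡n)
open import Data.Nat.Induction using (<-wellFounded)
open import Induction.WellFounded using (Acc; acc)
open import Data.Bool using (Bool; true; false)
open import Level using (0ℓ)
import Data.Bool.Properties as BoolP
open import Data.Fin using (Fin; zero; suc)
import Data.Fin as F
import Data.Fin.Properties as FinP
open import Data.Fin.Subset using (Subset; ⁅_⁆; _∪_) renaming (_∈_ to _∈ₛ_)
import Data.Fin.Subset as S
import Data.Fin.Subset.Properties as SubsetP
open import Data.Vec using ([]; _∷_; tabulate)
import Data.Vec.Properties as VecP
open import Data.List using (List; []; _∷_; _++_; head; last; length; lookup)
open import Data.List.Properties using (++-assoc; length-++)
open import Data.List.Membership.Propositional using (_∈_)
open import Data.List.Membership.Propositional.Properties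
  using (∈-++⁺ˡ; ∈-++⁺ʳ; ∈-++⁻; ∈-∃++; ∈-lookup)
import Data.List.Membership.DecPropositional as ListMembershipDec
open import Data.List.Relation.Binary.Subset.Propositional using (_⊆_)
open import Data.List.Relation.Unary.Any using (here; there)
import Data.List.Relation.Unary.All as All
open import Data.List.Relation.Unary.AllPairs using (_∷_)
open import Data.List.Relation.Unary.Linked as Linked using (Linked; [-]; _∷_; _∷′_; head′; linked?)
open import Data.List.Relation.Unary.Unique.Propositional using (Unique)
import Data.List.Relation.Unary.Unique.DecPropositional as UniqueDec
open import Data.Maybe using (just)
import Data.Maybe.Properties as MaybeP
open import Data.Maybe.Relation.Binary.Connected using (Connected)
open import Data.Product using (Σ; ∃; _×_; _,_; proj₁; proj₂)
open import Data.Sum using (inj₁; inj₂)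
open import Data.Empty using (⊥-elim)
open import Function.Bundles using (_⇔_; mk⇔; Equivalence)
open import Relation.Binary.Core using (Rel)
open import Relation.Binary.PropositionalEquality using (_≡_; _≢_; refl; sym; trans; cong; subst)
open import Relation.Nullary using (¬_; Dec; yes; no)
open import Relation.Nullary.Decidable using (_×-dec_; ¬?)

module Cycles {A : Set} where

  data Repeats : List A → Set where
    repeat : ∀ a x b c → Repeats (a ++ x ∷ b ++ x ∷ c)

  repeated-lookup : ∀ (l : List A) i j → i F.< j → lookup l i ≡ lookup l j → Repeats l
  repeated-lookup (y ∷ l) zero (suc j) _ y≡lⱼ with ∈-∃++ (subst (_∈ l) (sym y≡lⱼ) (∈-lookup j))
  ... | b , c , refl = repeat [] y b c
  repeated-lookup (y ∷ l) (suc i) (suc j) (s≤s i<j) lᵢ≡lⱼ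
    with repeated-lookup l i j i<j lᵢ≡lⱼ
  ... | repeat a x b c = repeat (y ∷ a) x b c

  unique⇒¬repeats : ∀ {l} → Unique l → ¬ Repeats l
  unique⇒¬repeats u (repeat a x b c) = go a u
    where
    go : ∀ a → ¬ Unique (a ++ x ∷ b ++ x ∷ c)
    go []      (x∉rest ∷ _) = All.lookup x∉rest (∈-++⁺ʳ b (here refl)) refl
    go (_ ∷ a) (_ ∷ u)      = go a u

  two-visits : ∀ l (y : A) m z r → 2 ≤ length (l ++ y ∷ m ++ z ∷ r)
  two-visits []      y []      z r = s≤s (s≤s z≤n)
  two-visits []      y (_ ∷ m) z r = s≤s (s≤s z≤n)
  two-visits (_ ∷ l) y m z r = m≤n⇒m≤1+n (two-visits l y m z r)

  head-cut : ∀ a (x : A) r s → head (a ++ x ∷ r) ≡ head (a ++ x ∷ s)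
  head-cut []      x r s = refl
  head-cut (_ ∷ a) x r s = refl

  last-++ : ∀ a (y : A) r → last (a ++ y ∷ r) ≡ last (y ∷ r)
  last-++ []          y r = refl
  last-++ (_ ∷ [])    y r = refl
  last-++ (_ ∷ w ∷ a) y r = last-++ (w ∷ a) y r

  last-cut : ∀ a (x : A) b c → last (a ++ x ∷ c) ≡ last (a ++ x ∷ b ++ x ∷ c)
  last-cut a x b c = trans (last-++ a x c)
    (trans (sym (last-++ (x ∷ b) x c)) (sym (last-++ a x (b ++ x ∷ c))))

  length-cut : ∀ a (x : A) b c → length (a ++ x ∷ c) < length (a ++ x ∷ b ++ x ∷ c)
  length-cut []      x []      c = ≤-refl
  length-cut []      x (_ ∷ b) c = m≤n⇒m≤1+n (length-cut [] x b c)
  length-cut (_ ∷ a) x b       c = s≤s (length-cut a x b c)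

  ⊆-cut : ∀ a (x : A) b c → a ++ x ∷ c ⊆ a ++ x ∷ b ++ x ∷ c
  ⊆-cut a x b c z∈ with ∈-++⁻ a z∈
  ... | inj₁ z∈a         = ∈-++⁺ˡ z∈a
  ... | inj₂ (here z≡x)  = ∈-++⁺ʳ a (here z≡x)
  ... | inj₂ (there z∈c) = ∈-++⁺ʳ a (there (∈-++⁺ʳ b (there z∈c)))

  linked-suffix : ∀ {R : Rel A 0ℓ} a q → Linked R (a ++ q) → Linked R q
  linked-suffix []      q l = l
  linked-suffix (_ ∷ a) q l = linked-suffix a q (Linked.tail l)

  linked-cut : ∀ {R : Rel A 0ℓ} a x b c → Linked R (a ++ x ∷ b ++ x ∷ c) → Linked R (a ++ x ∷ c)
  linked-cut []      x b c l = linked-suffix (x ∷ b) (x ∷ c) l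
  linked-cut {R} (y ∷ a) x b c l =
    subst (Connected R (just y)) (head-cut a x (b ++ x ∷ c) c) (head′ l)
      ∷′ linked-cut a x b c (Linked.tail l)

  record Shortcut (R : Rel A 0ℓ) (u : A) (p q : List A) : Set where
    field
      shorter    : length q < length p
      linked     : Linked R q
      same-head  : head q ≡ head p
      same-last  : last q ≡ last p
      visits     : u ∈ q
      nontrivial : 2 ≤ length q
      within     : q ⊆ p

  cut : ∀ {R : Rel A 0ℓ} {u} a x b c → Linked R (a ++ x ∷ b ++ x ∷ c) →
        u ∈ a ++ x ∷ c → 2 ≤ length (a ++ x ∷ c) →
        Shortcut R u (a ++ x ∷ b ++ x ∷ c) (a ++ x ∷ c)
  cut a x b c l u∈ two = record
    { shorter = length-cut a x b c ; linked = linked-cut a x b c l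
    ; same-head = head-cut a x c (b ++ x ∷ c) ; same-last = last-cut a x b c
    ; visits = u∈ ; nontrivial = two ; within = ⊆-cut a x b c }

  cut-before : ∀ {R : Rel A 0ℓ} {l} → Repeats l → ∀ u r → Linked R (l ++ u ∷ r) →
               ∃ λ q → Shortcut R u (l ++ u ∷ r) q
  cut-before (repeat a x b c) u r l =
    subst (λ p → ∃ λ q → Shortcut _ u p q) (sym reassoc)
      (_ , cut a x b (c ++ u ∷ r) (subst (Linked _) reassoc l)
             (∈-++⁺ʳ a (there (∈-++⁺ʳ c (here refl)))) (two-visits a x c u r))
    where
    reassoc : (a ++ x ∷ b ++ x ∷ c) ++ u ∷ r ≡ a ++ x ∷ b ++ x ∷ (c ++ u ∷ r)
    reassoc = trans (++-assoc a _ _) (cong (λ z → a ++ x ∷ z) (++-assoc b (x ∷ c) (u ∷ r)))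

  cut-after : ∀ {R : Rel A 0ℓ} l u {r} → Repeats r → Linked R (l ++ u ∷ r) →
              ∃ λ q → Shortcut R u (l ++ u ∷ r) q
  cut-after l u (repeat a x b c) lk =
    subst (λ p → ∃ λ q → Shortcut _ u p q) reassoc
      (_ , cut (l ++ u ∷ a) x b c (subst (Linked _) (sym reassoc) lk)
             (∈-++⁺ˡ (∈-++⁺ʳ l (here refl)))
             (subst (λ z → 2 ≤ length z) (sym (++-assoc l (u ∷ a) (x ∷ c))) (two-visits l u a x c)))
    where
    reassoc : (l ++ u ∷ a) ++ x ∷ b ++ x ∷ c ≡ l ++ u ∷ (a ++ x ∷ b ++ x ∷ c)
    reassoc = ++-assoc l (u ∷ a) _

open Cycles

module _ {n : ℕ} where

  pigeonhole : (l : List (Fin n)) → n < length l → Repeats l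
  pigeonhole l n<len with FinP.pigeonhole n<len (lookup l)
  ... | i , j , i<j , lᵢ≡lⱼ = repeated-lookup l i j i<j lᵢ≡lⱼ

  unique⇒length≤ : {l : List (Fin n)} → Unique l → length l ≤ n
  unique⇒length≤ {l} u with length l ≤? n
  ... | yes ok  = ok
  ... | no long = ⊥-elim (unique⇒¬repeats u (pigeonhole l (≰⇒> long)))

  walk-shortcut : ∀ {R : Rel (Fin n) 0ℓ} {p u} → Linked R p → u ∈ p →
                  suc (n + n) < length p → ∃ λ q → Shortcut R u p q
  walk-shortcut {u = u} lk u∈p long with ∈-∃++ u∈p
  ... | l , r , refl with n <? length l | n <? length r
  ...   | yes l-long | _          = cut-before (pigeonhole l l-long) u r lk
  ...   | no _       | yes r-long = cut-after l u (pigeonhole r r-long) lk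
  ...   | no l-short | no r-short = ⊥-elim (≤⇒≯ bounded long)
    where
    bounded : length (l ++ u ∷ r) ≤ suc (n + n)
    bounded = subst (_≤ suc (n + n)) (sym (length-++ l))
      (subst (length l + suc (length r) ≤_) (+-suc n n)
        (+-mono-≤ (≮⇒≥ l-short) (s≤s (≮⇒≥ r-short))))

  bounded-search : ∀ B {Q : List (Fin n) → Set} → (∀ p → Dec (Q p)) →
                   Dec (∃ λ p → length p ≤ B × Q p)
  bounded-search B Q? with Q? []
  ... | yes q = yes ([] , z≤n , q)
  bounded-search zero    Q? | no ¬q = no λ { ([] , _ , q) → ¬q q ; (_ ∷ _ , () , _) }
  bounded-search (suc B) Q? | no ¬q with FinP.any? (λ x → bounded-search B (λ p → Q? (x ∷ p)))
  ... | yes (x , p , le , q) = yes (x ∷ p , s≤s le , q)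
  ... | no ¬e = no λ { ([] , _ , q) → ¬q q ; (x ∷ p , s≤s le , q) → ¬e (x , p , le , q) }

module Decision {n : ℕ} (G : Graph n) (χ : Placement n) where

  walk? : ∀ p → Dec (Walk G p)
  walk? = linked? λ x y → adj G x y BoolP.≟ true

  head? : ∀ (p : List (Fin n)) s → Dec (head p ≡ just s)
  head? p s = MaybeP.≡-dec FinP._≟_ (head p) (just s)

  last? : ∀ (p : List (Fin n)) t → Dec (last p ≡ just t)
  last? p t = MaybeP.≡-dec FinP._≟_ (last p) (just t)

  measurement? : ∀ r p → Dec (Measurement r G χ p)
  measurement? CSP p = walk? p ×-dec UniqueDec.unique? FinP._≟_ p ×-dec
    FinP.any? (λ s → FinP.any? λ t → head? p s ×-dec last? p t ×-dec
      (s SubsetP.∈? inputs χ) ×-dec (t SubsetP.∈? outputs χ) ×-dec ¬? (s FinP.≟ t))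
  measurement? CAP⁻ p = walk? p ×-dec
    FinP.any? (λ s → FinP.any? λ t → head? p s ×-dec last? p t ×-dec
      (s SubsetP.∈? inputs χ) ×-dec (t SubsetP.∈? outputs χ) ×-dec (2 ≤? length p))

  inP? : ∀ (U : Subset n) p → Dec (InP U p)
  inP? U p = FinP.any? λ u → (u SubsetP.∈? U) ×-dec (ListMembershipDec._∈?_ FinP._≟_ u p)

  Separates : Routing → Subset n → Subset n → List (Fin n) → Set
  Separates r X Y p = Measurement r G χ p × InP X p × ¬ InP Y p

  separates? : ∀ r X Y p → Dec (Separates r X Y p)
  separates? r X Y p = measurement? r p ×-dec inP? X p ×-dec ¬? (inP? Y p)

  bound : Routing → ℕ
  bound CSP  = n
  bound CAP⁻ = suc (n + n)

  shortcut-separates : ∀ {X Y p q u} → u ∈ₛ X → Shortcut (Adj G) u p q →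
                       Separates CAP⁻ X Y p → Separates CAP⁻ X Y q
  shortcut-separates u∈X sc ((_ , s , t , hs , lt , s∈ , t∈ , _) , _ , avoids) =
    (linked , s , t , trans same-head hs , trans same-last lt , s∈ , t∈ , nontrivial) ,
    (_ , u∈X , visits) , λ { (w , w∈Y , w∈q) → avoids (w , w∈Y , within w∈q) }
    where open Shortcut sc

  short-separation : ∀ r X Y p → Separates r X Y p →
                     ∃ λ q → length q ≤ bound r × Separates r X Y q
  short-separation CSP  X Y p sep = p , unique⇒length≤ (proj₁ (proj₂ (proj₁ sep))) , sep
  short-separation CAP⁻ X Y p sep = go p sep (<-wellFounded (length p))
    where
    go : ∀ p → Separates CAP⁻ X Y p → Acc _<_ (length p) →
         ∃ λ q → length q ≤ suc (n + n) × Separates CAP⁻ X Y q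
    go p sep (acc smaller) with length p ≤? suc (n + n)
    ... | yes short = p , short , sep
    ... | no long with proj₁ (proj₂ sep)
    ...   | u , u∈X , u∈p with walk-shortcut (proj₁ (proj₁ sep)) u∈p (≰⇒> long)
    ...     | q , sc = go q (shortcut-separates u∈X sc sep) (smaller (Shortcut.shorter sc))

  separation? : ∀ r X Y → Dec (∃ (Separates r X Y))
  separation? r X Y with bounded-search (bound r) (separates? r X Y)
  ... | yes (p , _ , sep) = yes (p , sep)
  ... | no ¬short = no λ (p , sep) → ¬short (short-separation r X Y p sep)

  same? : ∀ r U W → Dec (SamePaths r G χ U W)
  same? r U W with separation? r U W | separation? r W U
  ... | yes (p , m , inU , ¬inW) | _ = no λ same → ¬inW (Equivalence.to (same p m) inU)
  ... | _ | yes (p , m , inW , ¬inU) = no λ same → ¬inU (Equivalence.from (same p m) inW)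
  ... | no ¬UW | no ¬WU = yes λ p m → mk⇔ (to p m) (from p m)
    where
    to : ∀ p → Measurement r G χ p → InP U p → InP W p
    to p m inU with inP? W p
    ... | yes inW = inW
    ... | no ¬inW = ⊥-elim (¬UW (p , m , inU , ¬inW))
    from : ∀ p → Measurement r G χ p → InP W p → InP U p
    from p m inW with inP? U p
    ... | yes inU = inU
    ... | no ¬inU = ⊥-elim (¬WU (p , m , inW , ¬inU))

  Confusable : Routing → ℕ → Subset n → Subset n → Set
  Confusable r k U W = S.∣ U ∣ ≤ k × S.∣ W ∣ ≤ k × U ≢ W × SamePaths r G χ U W

  confusable? : ∀ r k U W → Dec (Confusable r k U W)
  confusable? r k U W = (S.∣ U ∣ ≤? k) ×-dec (S.∣ W ∣ ≤? k) ×-dec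
                        ¬? (VecP.≡-dec BoolP._≟_ U W) ×-dec same? r U W

  identifiable? : ∀ r k → Dec (Identifiable r G χ k)
  identifiable? r k with SubsetP.anySubset? (λ U → SubsetP.anySubset? (confusable? r k U))
  ... | yes (U , W , cU , cW , U≢W , same) = no λ ident → ident U W cU cW U≢W same
  ... | no ¬conf = yes λ U W cU cW U≢W same → ¬conf (U , W , cU , cW , U≢W , same)

open Decision using (identifiable?)

minOver-attained : ∀ {m} (f : Fin (suc m) → ℕ) → ∃ λ i → f i ≡ minOver f
minOver-attained {zero}  f = zero , refl
minOver-attained {suc m} f with ≤-total (f zero) (minOver (λ i → f (suc i)))
... | inj₁ le = zero , sym (m≤n⇒m⊓n≡m le)
... | inj₂ ge with minOver-attained (λ i → f (suc i))
...   | i , eq = suc i , trans eq (sym (m≥n⇒m⊓n≡n ge))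

∣tabulate∣ : ∀ {n} (f : Fin n → Bool) → S.∣ tabulate f ∣ ≡ count f
∣tabulate∣ {zero}  f = refl
∣tabulate∣ {suc n} f with f zero
... | true  = cong suc (∣tabulate∣ (λ i → f (suc i)))
... | false = ∣tabulate∣ (λ i → f (suc i))

∈-tabulate : ∀ {n} (f : Fin n → Bool) {y} → y ∈ₛ tabulate f ⇔ f y ≡ true
∈-tabulate f {y} = mk⇔
  (λ y∈ → trans (sym (VecP.lookup∘tabulate f y)) (VecP.[]=⇒lookup y∈))
  (λ fy → VecP.lookup⇒[]= y (tabulate f) (trans (VecP.lookup∘tabulate f y) fy))

∣⁅x⁆∪p∣≤1+∣p∣ : ∀ {n} (x : Fin n) (p : Subset n) → S.∣ ⁅ x ⁆ ∪ p ∣ ≤ suc S.∣ p ∣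
∣⁅x⁆∪p∣≤1+∣p∣ zero    (b ∷ p) = s≤s (≤-trans (≤-reflexive (cong S.∣_∣ (SubsetP.∪-identityˡ p)))
                                           (SubsetP.∣p∣≤∣x∷p∣ b p))
∣⁅x⁆∪p∣≤1+∣p∣ (suc x) (false ∷ p) = ∣⁅x⁆∪p∣≤1+∣p∣ x p
∣⁅x⁆∪p∣≤1+∣p∣ (suc x) (true ∷ p)  = s≤s (∣⁅x⁆∪p∣≤1+∣p∣ x p)

neighbour-on-walk : ∀ {n} (G : Graph n) {p v} → Walk G p → 2 ≤ length p → v ∈ p →
                    ∃ λ y → Adj G v y × y ∈ p
neighbour-on-walk G [-] (s≤s ()) _
neighbour-on-walk G {_ ∷ y ∷ _} (xy ∷ _) _ (here refl) = y , xy , there (here refl)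
neighbour-on-walk G {x ∷ y ∷ _} (xy ∷ _) _ (there (here refl)) = x , trans (Graph.sym G y x) xy , here refl
neighbour-on-walk G {_ ∷ _ ∷ _ ∷ _} (_ ∷ lk) _ (there (there v∈)) with
  neighbour-on-walk G lk (s≤s (s≤s z≤n)) (there v∈)
... | y , vy , y∈ = y , vy , there y∈

measurement-walk : ∀ {n} r (G : Graph n) χ {p} → Measurement r G χ p → Walk G p × 2 ≤ length p
measurement-walk CSP  G χ {x ∷ y ∷ _} (lk , _) = lk , s≤s (s≤s z≤n)
measurement-walk CSP  G χ {x ∷ []} (_ , _ , s , t , refl , refl , _ , _ , s≢t) = ⊥-elim (s≢t refl)
measurement-walk CAP⁻ G χ (lk , _ , _ , _ , _ , _ , _ , two) = lk , two

not-identifiable : ∀ {m} (G : Graph (suc m)) χ r → ¬ Identifiable r G χ (suc (δ G))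
not-identifiable G χ r ident = ident N N[v] ∣N∣≤ ∣N[v]∣≤ N≢N[v] same
  where
  v = proj₁ (minOver-attained (degree G))
  N = tabulate (adj G v)
  N[v] = ⁅ v ⁆ ∪ N
  ∣N∣≡δ : S.∣ N ∣ ≡ δ G
  ∣N∣≡δ = trans (∣tabulate∣ (adj G v)) (proj₂ (minOver-attained (degree G)))
  ∣N∣≤ : S.∣ N ∣ ≤ suc (δ G)
  ∣N∣≤ = ≤-trans (≤-reflexive ∣N∣≡δ) (n≤1+n _)
  ∣N[v]∣≤ : S.∣ N[v] ∣ ≤ suc (δ G)
  ∣N[v]∣≤ = ≤-trans (∣⁅x⁆∪p∣≤1+∣p∣ v N) (s≤s (≤-reflexive ∣N∣≡δ))
  v∉N : ¬ v ∈ₛ N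
  v∉N v∈N with trans (sym (irrfl G v)) (Equivalence.to (∈-tabulate (adj G v)) v∈N)
  ... | ()
  N≢N[v] : N ≢ N[v]
  N≢N[v] eq = v∉N (subst (v ∈ₛ_) (sym eq) (SubsetP.x∈p∪q⁺ (inj₁ (SubsetP.x∈⁅x⁆ v))))
  same : SamePaths r G χ N N[v]
  same p m = mk⇔ (λ (u , u∈ , u∈p) → u , SubsetP.x∈p∪q⁺ (inj₂ u∈) , u∈p) from
    where
    from : InP N[v] p → InP N p
    from (w , w∈ , w∈p) with SubsetP.x∈p∪q⁻ ⁅ v ⁆ N w∈
    ... | inj₂ w∈N = w , w∈N , w∈p
    ... | inj₁ w∈⁅v⁆ with SubsetP.x∈⁅y⁆⇒x≡y v w∈⁅v⁆
    ...   | refl with neighbour-on-walk G (proj₁ (measurement-walk r G χ m))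
                                          (proj₂ (measurement-walk r G χ m)) w∈p
    ...     | y , wy , y∈p = y , Equivalence.from (∈-tabulate (adj G v)) wy , y∈p

largest-below : (P : ℕ → Set) → (∀ k → Dec (P k)) → (∀ {j k} → j ≤ k → P k → P j) →
  ∀ D → P 0 → ¬ P (suc D) → Σ ℕ λ μ → (P μ × (∀ k → P k → k ≤ μ)) × μ ≤ D
largest-below P P? down D p₀ ¬p with P? D
... | yes pD = D , (pD , bounded) , ≤-refl
  where
  bounded : ∀ k → P k → k ≤ D
  bounded k pk with k ≤? D
  ... | yes k≤D = k≤D
  ... | no k≰D  = ⊥-elim (¬p (down (≰⇒> k≰D) pk))
largest-below P P? down zero    p₀ ¬p | no ¬p₀ = ⊥-elim (¬p₀ p₀)
largest-below P P? down (suc D) p₀ ¬p | no ¬pD with largest-below P P? down D p₀ ¬pD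
... | μ , largest , μ≤D = μ , largest , m≤n⇒m≤1+n μ≤D

-- Every set is 0-identifiable: only the empty set has size 0.
zero-identifiable : ∀ {n} r (G : Graph n) χ → Identifiable r G χ 0
zero-identifiable r G χ U W ∣U∣≤0 ∣W∣≤0 U≢W _ =
  U≢W (trans (empty U ∣U∣≤0) (sym (empty W ∣W∣≤0)))
  where
  empty : ∀ {k} (X : Subset k) → S.∣ X ∣ ≤ 0 → X ≡ S.⊥
  empty []          _  = refl
  empty (false ∷ X) le = cong (false ∷_) (empty X le)

identifiable-down : ∀ {n} r (G : Graph n) χ {j k} → j ≤ k →
                    Identifiable r G χ k → Identifiable r G χ j
identifiable-down r G χ j≤k ident U W cU cW = ident U W (≤-trans cU j≤k) (≤-trans cW j≤k)

lemma1 : ∀ {m} (G : Graph (suc m)) (χ : Placement (suc m)) (r : Routing) →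
           Σ ℕ λ μ → IsMu r G χ μ × μ ≤ δ G
lemma1 G χ r =
  largest-below (Identifiable r G χ) (identifiable? G χ r) (identifiable-down r G χ)
    (δ G) (zero-identifiable r G χ) (not-identifiable G χ r)
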